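{- Let $R$ be a tolerance on $U$ induced by an irredundant covering of $U$. (a) If $R(x)$ is a block with $|R(x)|\ge 2$, then $g((\emptyset,R(x)))=(R(x)^{\downarrow},R(x)^{\uparrow})$ and $g((R(x)^{\downarrow},R(x)^{\uparrow}))=(\emptyset,R(x))$. (b) If $R(x)=\{x\}$, then $g((\{x\},\{x\}))=(\{x\},\{x\})$.
   Context: A tolerance on $U$ is a reflexive symmetric relation; $R(x)=\{y\mid x\,R\,y\}$; $X^{\downarrow}=\{x\mid R(x)\subseteq X\}$, $X^{\uparrow}=\{x\mid R(x)\cap X\neq\emptyset\}$, $X^c=U\setminus X$. A block of $R$ is a maximal nonempty $X$ with $X\times X\subseteq R$. A covering is a family of nonempty subsets of $U$ with union $U$, irredundant if no member can be removed keeping a covering; its induced tolerance is $\bigcup\{X\times X\mid X\in\mathcal{H}\}$. $\mathit{RS}=\{(X^{\downarrow},X^{\uparrow})\mid X\subseteq U\}$ ordered coordinatewise; for such $R$ it is a complete lattice and a Kleene algebra with ${\sim}(A,B)=(B^c,A^c)$. Let $\mathcal{J}(\mathit{RS})$ be its set of completely join-irreducible elements (elements $j$ with $j=\bigvee S\Rightarrow j\in S$). Define $g\colon\mathcal{J}(\mathit{RS})\to\mathcal{J}(\mathit{RS})$ by $g((C,D))=\bigwedge\{(X^{\downarrow},X^{\uparrow})\in\mathit{RS}\mid (X^{\downarrow},X^{\uparrow})\not\le(D^c,C^c)\}$, the meet taken in $\mathit{RS}$. -}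

module Defs where

open import Level using (Level; 0ℓ) renaming (suc to lsuc)
open import Data.Product using (Σ; ∃; ∃-syntax; _×_; _,_)
open import Data.Empty using (⊥)
open import Relation.Nullary using (¬_)
open import Relation.Binary.PropositionalEquality using (_≡_; _≢_)

Subset : Set → Set₁
Subset U = U → Set

module _ {U : Set} where

  _⊆_ : Subset U → Subset U → Set
  X ⊆ Y = ∀ y → X y → Y y

  _≐_ : Subset U → Subset U → Set
  X ≐ Y = (X ⊆ Y) × (Y ⊆ X)

  ∅ : Subset U
  ∅ _ = ⊥

  ｛_｝ : U → Subset U
  ｛ x ｝ y = y ≡ x

  _ᶜ : Subset U → Subset U
  (X ᶜ) y = ¬ X y

record IrredundantCovering (U : Set) : Set₁ where
  field
    I          : Set
    H          : I → Subset U
    nonempty   : ∀ i → ∃[ y ] H i y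
    covers     : ∀ y → ∃[ i ] H i y
    irredundant : ∀ i → ¬ (∀ y → ∃[ j ] ((j ≢ i) × H j y))

module Tolerance {U : Set} (𝓗 : IrredundantCovering U) where
  open IrredundantCovering 𝓗

  R : U → U → Set
  R y z = ∃[ i ] (H i y × H i z)

  R[_] : U → Subset U
  R[ x ] y = R x y

  _↓ : Subset U → Subset U
  (X ↓) y = R[ y ] ⊆ X

  _↑ : Subset U → Subset U
  (X ↑) y = ∃[ z ] (R y z × X z)

  IsBlock : Subset U → Set₁
  IsBlock X = (∃[ y ] X y)
            × (∀ a b → X a → X b → R a b)
            × (∀ (Y : Subset U) → X ⊆ Y → (∀ a b → Y a → Y b → R a b) → Y ⊆ X)

  Pair : Set₁
  Pair = Subset U × Subset U

  _≤_ : Pair → Pair → Set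
  (A , B) ≤ (A' , B') = (A ⊆ A') × (B ⊆ B')

  -- membership in RS = { (X↓ , X↑) | X ⊆ U } (up to extensional equality)
  InRS : Pair → Set₁
  InRS (A , B) = Σ (Subset U) λ X → (A ≐ (X ↓)) × (B ≐ (X ↑))

  IsMeetRS : (Pair → Set₁) → Pair → Set₁
  IsMeetRS P m = InRS m
               × (∀ p → InRS p → P p → m ≤ p)
               × (∀ l → InRS l → (∀ p → InRS p → P p → l ≤ p) → l ≤ m)

  gFamily : Pair → Pair → Set₁
  gFamily (C , D) p = InRS p × ¬ (p ≤ ((D ᶜ) , (C ᶜ)))

  gIs : Pair → Pair → Set₁
  gIs c m = IsMeetRS (gFamily c) m

module Submission where

-- Irredundancy gives every member H i of the covering a private point p (one lying in no other
-- member), and then R(p) = H i.  When R(x) is a block through x ∈ H i, also R(x) = H i = R(p),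
-- which lets ({p}↓ , {p}↑) = (∅ , R(x)) be realised in RS.  In each case the claimed value of g
-- lies in the family defining g and is below each of its members, so it is its least element and
-- hence its meet; classically, (X↓ , X↑) ≰ (Dᶜ , Cᶜ) says that X↓ meets D or X↑ meets C, and this
-- is what the lower bounds are proved from.

open import Defs
open import Axiom.ExcludedMiddle using (ExcludedMiddle)
open import Axiom.DoubleNegationElimination using (em⇒dne)
open import Level using (0ℓ)
open import Data.Product using (∃-syntax; _×_; _,_; proj₁; proj₂)
open import Data.Sum using (_⊎_; inj₁; inj₂)
open import Data.Empty using (⊥-elim)
open import Relation.Nullary using (¬_; yes; no)
open import Relation.Binary.PropositionalEquality using (_≡_; _≢_; refl; sym; trans; subst)

module _ {U : Set} where

  ⊆-refl : {X : Subset U} → X ⊆ X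
  ⊆-refl _ x = x

  ⊆-trans : {X Y Z : Subset U} → X ⊆ Y → Y ⊆ Z → X ⊆ Z
  ⊆-trans X⊆Y Y⊆Z y x = Y⊆Z y (X⊆Y y x)

  ≐-refl : {X : Subset U} → X ≐ X
  ≐-refl = ⊆-refl , ⊆-refl

  ≐-sym : {X Y : Subset U} → X ≐ Y → Y ≐ X
  ≐-sym (X⊆Y , Y⊆X) = Y⊆X , X⊆Y

  ≐-trans : {X Y Z : Subset U} → X ≐ Y → Y ≐ Z → X ≐ Z
  ≐-trans (X⊆Y , Y⊆X) (Y⊆Z , Z⊆Y) = ⊆-trans X⊆Y Y⊆Z , ⊆-trans Z⊆Y Y⊆X

  Meets : Subset U → Subset U → Set
  Meets X Y = ∃[ y ] (X y × Y y)

  ¬Meets⇒⊆ᶜ : {X Y : Subset U} → ¬ Meets X Y → X ⊆ (Y ᶜ)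
  ¬Meets⇒⊆ᶜ ¬meets y x y∈Y = ¬meets (y , x , y∈Y)

  Meets⇒⊈ᶜ : {X Y : Subset U} → Meets X Y → ¬ (X ⊆ (Y ᶜ))
  Meets⇒⊈ᶜ (y , x , y∈Y) X⊆Yᶜ = X⊆Yᶜ y x y∈Y

module _ {U : Set} (𝓗 : IrredundantCovering U) where
  open IrredundantCovering 𝓗
  open Tolerance 𝓗

  R-refl : ∀ y → R y y
  R-refl y = let (i , y∈Hi) = covers y in i , y∈Hi , y∈Hi

  R-sym : ∀ {y z} → R y z → R z y
  R-sym (i , y∈Hi , z∈Hi) = i , z∈Hi , y∈Hi

  ↓-mono : {X Y : Subset U} → X ⊆ Y → (X ↓) ⊆ (Y ↓)
  ↓-mono X⊆Y y R[y]⊆X = ⊆-trans R[y]⊆X X⊆Y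

  ↑-mono : {X Y : Subset U} → X ⊆ Y → (X ↑) ⊆ (Y ↑)
  ↑-mono X⊆Y y (z , Ryz , z∈X) = z , Ryz , X⊆Y z z∈X

  ↓-deflationary : (X : Subset U) → (X ↓) ⊆ X
  ↓-deflationary X y R[y]⊆X = R[y]⊆X y (R-refl y)

  ↑-inflationary : (X : Subset U) → X ⊆ (X ↑)
  ↑-inflationary X y y∈X = y , R-refl y , y∈X

  ｛｝↑≐R[_] : (p : U) → (｛ p ｝ ↑) ≐ R[ p ]
  ｛｝↑≐R[ p ] = (λ { y (.p , Ryp , refl) → R-sym Ryp }) , (λ y Rpy → p , R-sym Rpy , refl)

  ｛｝↓⊆∅ : (p : U) → (∃[ y ] ∃[ z ] (R[ p ] y × R[ p ] z × y ≢ z)) → (｛ p ｝ ↓) ⊆ ∅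
  ｛｝↓⊆∅ p (y , z , Rpy , Rpz , y≢z) q R[q]⊆｛p｝ with R[q]⊆｛p｝ q (R-refl q)
  ... | refl = y≢z (trans (R[q]⊆｛p｝ y Rpy) (sym (R[q]⊆｛p｝ z Rpz)))

  IsPrivate : U → I → Set
  IsPrivate p i = H i p × (∀ j → H j p → j ≡ i)

  private-point : ExcludedMiddle 0ℓ → ∀ i → ∃[ p ] IsPrivate p i
  private-point em i = p , subst (λ j → H j p) (only-i j₀ p∈Hj₀) p∈Hj₀ , only-i
    where
    dne = em⇒dne em
    lonely : ∃[ p ] ¬ (∃[ j ] ((j ≢ i) × H j p))
    lonely = dne λ none → irredundant i λ y → dne λ ¬shared → none (y , ¬shared)
    p = proj₁ lonely
    only-i : ∀ j → H j p → j ≡ i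
    only-i j p∈Hj = dne λ j≢i → proj₂ lonely (j , j≢i , p∈Hj)
    j₀ = proj₁ (covers p)
    p∈Hj₀ = proj₂ (covers p)

  R[private]≐H : ∀ {p i} → IsPrivate p i → R[ p ] ≐ H i
  R[private]≐H (p∈Hi , only-i) =
    (λ { z (j , p∈Hj , z∈Hj) → subst (λ k → H k z) (only-i j p∈Hj) z∈Hj }) ,
    (λ z z∈Hi → _ , p∈Hi , z∈Hi)

  IsClique : Subset U → Set
  IsClique X = ∀ a b → X a → X b → R a b

  IsBlock⇒IsClique : ∀ {X} → IsBlock X → IsClique X
  IsBlock⇒IsClique (_ , clique , _) = clique

  clique⇒⊆R[_] : ∀ {X} y → IsClique X → X y → X ⊆ R[ y ]
  clique⇒⊆R[ y ] clique y∈X z z∈X = clique y z y∈X z∈X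

  clique-R[_]≐R[private] : ∀ x {p i} → IsClique R[ x ] → H i x → IsPrivate p i → R[ x ] ≐ R[ p ]
  clique-R[ x ]≐R[private] clique x∈Hi p-private@(p∈Hi , _) =
    clique⇒⊆R[ _ ] clique (_ , x∈Hi , p∈Hi) ,
    ⊆-trans (proj₁ (R[private]≐H p-private)) (λ z z∈Hi → _ , x∈Hi , z∈Hi)

  -- The classical content of (X↓ , X↑) ≰ (Dᶜ , Cᶜ), the membership condition of g((C , D)).
  Overlaps : Pair → Subset U → Set
  Overlaps (C , D) X = Meets (X ↓) D ⊎ Meets (X ↑) C

  Overlaps⇒≰ : ∀ {C D X} → Overlaps (C , D) X → ¬ (((X ↓) , (X ↑)) ≤ ((D ᶜ) , (C ᶜ)))
  Overlaps⇒≰ (inj₁ meets) (X↓⊆Dᶜ , _) = Meets⇒⊈ᶜ meets X↓⊆Dᶜ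
  Overlaps⇒≰ (inj₂ meets) (_ , X↑⊆Cᶜ) = Meets⇒⊈ᶜ meets X↑⊆Cᶜ

  ≰⇒Overlaps : ExcludedMiddle 0ℓ → ∀ {C D X} → ¬ (((X ↓) , (X ↑)) ≤ ((D ᶜ) , (C ᶜ))) → Overlaps (C , D) X
  ≰⇒Overlaps em {C} {D} {X} ≰ with em {Meets (X ↓) D} | em {Meets (X ↑) C}
  ... | yes meets | _         = inj₁ meets
  ... | no _      | yes meets = inj₂ meets
  ... | no ¬meets | no ¬meets′ = ⊥-elim (≰ (¬Meets⇒⊆ᶜ ¬meets , ¬Meets⇒⊆ᶜ ¬meets′))

  ≤-transport : ∀ {A B A′ B′ E F} → A ≐ A′ → B ≐ B′ → (A , B) ≤ (E , F) → (A′ , B′) ≤ (E , F)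
  ≤-transport (_ , A′⊆A) (_ , B′⊆B) (A⊆E , B⊆F) = ⊆-trans A′⊆A A⊆E , ⊆-trans B′⊆B B⊆F

  gIs-least : ExcludedMiddle 0ℓ → ∀ {c A B} (Y : Subset U) → A ≐ (Y ↓) → B ≐ (Y ↑) →
              Overlaps c Y → (∀ X → Overlaps c X → (A , B) ≤ ((X ↓) , (X ↑))) → gIs c (A , B)
  gIs-least em {c} {A} {B} Y A≐ B≐ overlaps least =
    inRS , lower-bound , λ _ _ below → below (A , B) inRS member
    where
    inRS : InRS (A , B)
    inRS = Y , A≐ , B≐
    member : gFamily c (A , B)
    member = inRS , λ A,B≤ → Overlaps⇒≰ overlaps (≤-transport A≐ B≐ A,B≤)
    lower-bound : ∀ p → InRS p → gFamily c p → (A , B) ≤ p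
    lower-bound (A′ , B′) (X , A′≐@(_ , X↓⊆A′) , B′≐@(_ , X↑⊆B′)) (_ , A′,B′≰) =
      let (A⊆X↓ , B⊆X↑) = least X (≰⇒Overlaps em λ X≤ → A′,B′≰ (≤-transport (≐-sym A′≐) (≐-sym B′≐) X≤))
      in ⊆-trans A⊆X↓ X↓⊆A′ , ⊆-trans B⊆X↑ X↑⊆B′

  Overlaps-R[_]↓↑⇒Meets : ∀ x {X} → Overlaps ((R[ x ] ↓) , (R[ x ] ↑)) X → Meets X R[ x ]
  Overlaps-R[ x ]↓↑⇒Meets (inj₁ (a , R[a]⊆X , (w , Raw , Rxw))) = w , R[a]⊆X w Raw , Rxw
  Overlaps-R[ x ]↓↑⇒Meets (inj₂ (b , (w , Rbw , w∈X) , R[b]⊆R[x])) = w , w∈X , R[b]⊆R[x] w Rbw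

  module _ (em : ExcludedMiddle 0ℓ) (x : U) (clique : IsClique R[ x ]) where

    private
      i = proj₁ (covers x)
      x∈Hi = proj₂ (covers x)
      p = proj₁ (private-point em i)
      p-private = proj₂ (private-point em i)
      R[x]≐R[p] = clique-R[ x ]≐R[private] clique x∈Hi p-private

    clique⇒g-∅,R : gIs (∅ , R[ x ]) ((R[ x ] ↓) , (R[ x ] ↑))
    clique⇒g-∅,R = gIs-least em R[ x ] ≐-refl ≐-refl overlaps least
      where
      overlaps : Overlaps (∅ , R[ x ]) R[ x ]
      overlaps = inj₁ (p , proj₂ R[x]≐R[p] , proj₂ R[x]≐R[p] p (R-refl p))
      least : ∀ X → Overlaps (∅ , R[ x ]) X → ((R[ x ] ↓) , (R[ x ] ↑)) ≤ ((X ↓) , (X ↑))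
      least X (inj₁ (y , R[y]⊆X , Rxy)) = ↓-mono R[x]⊆X , ↑-mono R[x]⊆X
        where
        R[x]⊆X = ⊆-trans (clique⇒⊆R[ y ] clique Rxy) R[y]⊆X
      least X (inj₂ (_ , _ , ()))

    clique⇒g-R↓,R↑ : (∃[ y ] ∃[ z ] (R[ x ] y × R[ x ] z × y ≢ z)) → gIs ((R[ x ] ↓) , (R[ x ] ↑)) (∅ , R[ x ])
    clique⇒g-R↓,R↑ (y , z , Rxy , Rxz , y≢z) = gIs-least em ｛ p ｝ ∅≐ R[x]≐ overlaps least
      where
      R[x]⊆R[p] = proj₁ R[x]≐R[p]
      ∅≐ : ∅ ≐ (｛ p ｝ ↓)
      ∅≐ = (λ _ ()) , ｛｝↓⊆∅ p (y , z , R[x]⊆R[p] y Rxy , R[x]⊆R[p] z Rxz , y≢z)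
      R[x]≐ : R[ x ] ≐ (｛ p ｝ ↑)
      R[x]≐ = ≐-trans R[x]≐R[p] (≐-sym ｛｝↑≐R[ p ])
      overlaps : Overlaps ((R[ x ] ↓) , (R[ x ] ↑)) ｛ p ｝
      overlaps = inj₂ (p , ↑-inflationary ｛ p ｝ p refl , proj₂ R[x]≐R[p])
      least : ∀ X → Overlaps ((R[ x ] ↓) , (R[ x ] ↑)) X → (∅ , R[ x ]) ≤ ((X ↓) , (X ↑))
      least X overlapsX with Overlaps-R[ x ]↓↑⇒Meets overlapsX
      ... | (w , w∈X , Rxw) = (λ _ ()) , λ v Rxv → w , clique v w Rxv Rxw , w∈X

  singleton⇒g-｛｝ : ExcludedMiddle 0ℓ → ∀ x → R[ x ] ≐ ｛ x ｝ → gIs (｛ x ｝ , ｛ x ｝) (｛ x ｝ , ｛ x ｝)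
  singleton⇒g-｛｝ em x (R[x]⊆｛x｝ , _) = gIs-least em ｛ x ｝ ｛x｝≐↓ ｛x｝≐↑ overlaps least
    where
    ｛x｝≐↓ : ｛ x ｝ ≐ (｛ x ｝ ↓)
    ｛x｝≐↓ = (λ { _ refl → R[x]⊆｛x｝ }) , ↓-deflationary ｛ x ｝
    ｛x｝≐↑ : ｛ x ｝ ≐ (｛ x ｝ ↑)
    ｛x｝≐↑ = ↑-inflationary ｛ x ｝ , ⊆-trans (proj₁ ｛｝↑≐R[ x ]) R[x]⊆｛x｝
    overlaps : Overlaps (｛ x ｝ , ｛ x ｝) ｛ x ｝
    overlaps = inj₁ (x , R[x]⊆｛x｝ , refl)
    x∈ : ∀ {X} → Overlaps (｛ x ｝ , ｛ x ｝) X → X x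
    x∈ {X} (inj₁ (.x , x∈X↓ , refl)) = ↓-deflationary X x x∈X↓
    x∈ {X} (inj₂ (.x , (w , Rxw , w∈X) , refl)) = subst X (R[x]⊆｛x｝ w Rxw) w∈X
    least : ∀ X → Overlaps (｛ x ｝ , ｛ x ｝) X → (｛ x ｝ , ｛ x ｝) ≤ ((X ↓) , (X ↑))
    least X overlapsX =
      ⊆-trans (proj₁ ｛x｝≐↓) (↓-mono ｛x｝⊆X) , ⊆-trans (proj₁ ｛x｝≐↑) (↑-mono ｛x｝⊆X)
      where
      ｛x｝⊆X : ｛ x ｝ ⊆ X
      ｛x｝⊆X _ refl = x∈ overlapsX

lemma3p7 : ExcludedMiddle 0ℓ → (U : Set) (𝓗 : IrredundantCovering U) (x : U) →
    let open Tolerance 𝓗 in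
    (IsBlock R[ x ] → (∃[ y ] ∃[ z ] (R[ x ] y × R[ x ] z × y ≢ z)) →
    gIs (∅ , R[ x ]) ((R[ x ] ↓) , (R[ x ] ↑))
    × gIs ((R[ x ] ↓) , (R[ x ] ↑)) (∅ , R[ x ]))
    × (R[ x ] ≐ ｛ x ｝ → gIs (｛ x ｝ , ｛ x ｝) (｛ x ｝ , ｛ x ｝))
lemma3p7 em U 𝓗 x =
  (λ block distinct → clique⇒g-∅,R 𝓗 em x (IsBlock⇒IsClique 𝓗 block)
                    , clique⇒g-R↓,R↑ 𝓗 em x (IsBlock⇒IsClique 𝓗 block) distinct)
  , singleton⇒g-｛｝ 𝓗 em x
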